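{- Let $G$ be a simple graph on $n$ vertices with adjacency matrix $A$ and walk-matrix $W=[e,Ae,\dots,A^{n-1}e]$ ($e$ the all-one vector), and assume $\det(W)\neq0$. Let $Q$ be a rational orthogonal matrix with $Qe=e$ such that $Q^TAQ$ is a symmetric $(0,1)$-matrix with zero diagonal, let $\ell$ be its level, let $p$ be an odd prime dividing $\ell$, and assume $\mathrm{rank}_p(W)=n-1$. Let $z$ be an integral vector with $W^Tz\equiv0$, $z^Tz\equiv 0$, $z\not\equiv 0\pmod p$, and let $\lambda_0$ be an integer with $Az\equiv\lambda_0 z\pmod p$. If $\mathrm{rank}_p(A-\lambda_0 I)=n-2$, then $\mathrm{rank}_p([A-\lambda_0 I,\, z])=n-1$, where $[A-\lambda_0I,\,z]$ is the $n\times(n+1)$ matrix obtained by appending the column $z$ to $A-\lambda_0I$.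
   Context: The level of a rational matrix $Q$ is the smallest positive integer $\ell$ such that $\ell Q$ is integral. $\mathrm{rank}_p(M)$ denotes the rank of an integral matrix $M$ over $\mathbf{F}_p$. Congruences of vectors are entrywise. -}

module Defs where

open import Data.Nat as ℕ using (ℕ; zero; suc; _≤_; _<_)
open import Data.Nat.Primality using (Prime)
open import Data.Fin using (Fin; toℕ; punchIn; _≟_)
import Data.Fin as Fin
open import Data.Integer as ℤ using (ℤ; +_)
open import Data.Integer.Divisibility as ℤD using ()
open import Data.Rational as ℚ using (ℚ; 0ℚ; 1ℚ; ↧ₙ_)
open import Data.Product using (Σ; _×_; ∃-syntax)
open import Data.Sum using (_⊎_)
open import Relation.Binary.PropositionalEquality using (_≡_)
open import Relation.Nullary using (¬_; yes; no)

Matℤ : ℕ → ℕ → Set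
Matℤ m k = Fin m → Fin k → ℤ

Vecℤ : ℕ → Set
Vecℤ m = Fin m → ℤ

Matℚ : ℕ → ℕ → Set
Matℚ m k = Fin m → Fin k → ℚ

Σℤ : (n : ℕ) → (Fin n → ℤ) → ℤ
Σℤ zero f = + 0
Σℤ (suc n) f = f Fin.zero ℤ.+ Σℤ n (λ i → f (Fin.suc i))

Σℚ : (n : ℕ) → (Fin n → ℚ) → ℚ
Σℚ zero f = 0ℚ
Σℚ (suc n) f = f Fin.zero ℚ.+ Σℚ n (λ i → f (Fin.suc i))

_·ᵥ_ : ∀ {m k} → Matℤ m k → Vecℤ k → Vecℤ m
_·ᵥ_ {k = k} M v i = Σℤ k (λ j → M i j ℤ.* v j)

𝟙 : ∀ {n} → Vecℤ n
𝟙 _ = + 1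

walkVec : ∀ {n} → Matℤ n n → ℕ → Vecℤ n
walkVec A zero = 𝟙
walkVec A (suc j) = A ·ᵥ walkVec A j

walkMatrix : ∀ {n} → Matℤ n n → Matℤ n n
walkMatrix A i j = walkVec A (toℕ j) i

transposeℤ : ∀ {m k} → Matℤ m k → Matℤ k m
transposeℤ M i j = M j i

signℤ : ℕ → ℤ
signℤ zero = + 1
signℤ (suc j) = ℤ.- signℤ j

det : (n : ℕ) → Matℤ n n → ℤ
det zero M = + 1
det (suc n) M =
  Σℤ (suc n) (λ j → signℤ (toℕ j) ℤ.* (M Fin.zero j ℤ.* det n (λ r c → M (Fin.suc r) (punchIn j c))))

IsAdjacencyℤ : ∀ {n} → Matℤ n n → Set
IsAdjacencyℤ A =
  (∀ i j → A i j ≡ + 0 ⊎ A i j ≡ + 1) × (∀ i j → A i j ≡ A j i) × (∀ i → A i i ≡ + 0)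

IsAdjacencyℚ : ∀ {n} → Matℚ n n → Set
IsAdjacencyℚ B =
  (∀ i j → B i j ≡ 0ℚ ⊎ B i j ≡ 1ℚ) × (∀ i j → B i j ≡ B j i) × (∀ i → B i i ≡ 0ℚ)

toℚ : ℤ → ℚ
toℚ z = z ℚ./ 1

δℚ : ∀ {n} → Fin n → Fin n → ℚ
δℚ i j with i ≟ j
... | yes _ = 1ℚ
... | no _ = 0ℚ

IsOrthogonal : ∀ {n} → Matℚ n n → Set
IsOrthogonal {n} Q = ∀ i j → Σℚ n (λ k → Q k i ℚ.* Q k j) ≡ δℚ i j

FixesOnes : ∀ {n} → Matℚ n n → Set
FixesOnes {n} Q = ∀ i → Σℚ n (λ j → Q i j) ≡ 1ℚ

conjugate : ∀ {n} → Matℚ n n → Matℤ n n → Matℚ n n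
conjugate {n} Q A i j =
  Σℚ n (λ k → Σℚ n (λ l → Q k i ℚ.* (toℚ (A k l) ℚ.* Q l j)))

IsIntegralℚ : ℚ → Set
IsIntegralℚ q = ↧ₙ q ≡ 1

ScalesToIntegral : ∀ {n} → ℕ → Matℚ n n → Set
ScalesToIntegral ℓ Q = ∀ i j → IsIntegralℚ (toℚ (+ ℓ) ℚ.* Q i j)

IsLevel : ∀ {n} → Matℚ n n → ℕ → Set
IsLevel Q ℓ = 0 < ℓ × ScalesToIntegral ℓ Q × (∀ m → 0 < m → ScalesToIntegral m Q → ℓ ≤ m)

_≡_[mod_] : ℤ → ℤ → ℕ → Set
x ≡ y [mod p ] = (+ p) ℤD.∣ (x ℤ.- y)

ColumnsIndependentMod : (p : ℕ) → ∀ {m k r} → Matℤ m k → (Fin r → Fin k) → Set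
ColumnsIndependentMod p {m} {k} {r} M f =
  ∀ (c : Fin r → ℤ) →
    (∀ i → Σℤ r (λ t → c t ℤ.* M i (f t)) ≡ + 0 [mod p ]) →
    ∀ t → c t ≡ + 0 [mod p ]

RankMod : (p : ℕ) → ∀ {m k} → Matℤ m k → ℕ → Set
RankMod p {m} {k} M r =
  (Σ (Fin r → Fin k) λ f → ColumnsIndependentMod p M f) ×
  (∀ (f : Fin (suc r) → Fin k) → ¬ ColumnsIndependentMod p M f)

idℤ : ∀ {n} → Matℤ n n
idℤ i j with i ≟ j
... | yes _ = + 1
... | no _ = + 0

shift : ∀ {n} → Matℤ n n → ℤ → Matℤ n n
shift A λ₀ i j = A i j ℤ.- λ₀ ℤ.* idℤ i j

appendCol : ∀ {m k} → Matℤ m k → Vecℤ m → Matℤ m (suc k)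
appendCol {k = k} M z i j with Fin.toℕ j ℕ.<? k
appendCol {k = k} M z i j | yes j<k = M i (Fin.fromℕ< j<k)
appendCol {k = k} M z i j | no _ = z i

module Submission where

open import Defs
open import Data.Nat using (ℕ; _∸_)
open import Data.Nat.Divisibility using (_∣_)
open import Data.Nat.Primality using (Prime)
open import Data.Integer using (ℤ; +_; _*_)
open import Data.Rational using (ℚ)
open import Data.Fin using (Fin)
open import Relation.Binary.PropositionalEquality using (_≢_)
open import Relation.Nullary using (¬_)

open import Data.Nat using (zero; suc; _<_)
open import Data.Nat.Primality using (euclidsLemma; ¬prime[1])
import Data.Nat.Properties as ℕ
import Data.Nat.Divisibility as ℕ∣
open import Data.Integer using (_+_; _-_; -_; ∣_∣)
import Data.Integer.Properties as ℤ
import Data.Integer.Divisibility.Signed as ℤ∣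
open import Data.Integer.Tactic.RingSolver using (solve-∀)
open import Data.Fin using (zero; suc; punchIn; punchOut; toℕ; fromℕ; fromℕ<; inject₁; _≟_)
import Data.Fin.Properties as FinP
open import Data.Vec.Functional using (insertAt)
open import Data.Vec.Functional.Properties using (insertAt-lookup; insertAt-punchIn)
open import Algebra.Properties.Semiring.Sum ℤ.+-*-semiring
  using (sum; sum-cong-≗; sum-replicate-zero; ∑-distrib-+; ∑-comm; sum-remove; *-distribˡ-sum; *-distribʳ-sum)
open import Data.Product using (Σ; _×_; _,_; proj₁; proj₂)
open import Data.Sum using (_⊎_; inj₁; inj₂)
open import Data.Empty using (⊥-elim)
open import Relation.Nullary using (Dec; yes; no)
open import Relation.Nullary.Decidable using (decidable-stable)
open import Function using (_∘_)
open import Relation.Binary.PropositionalEquality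
  using (_≡_; refl; sym; trans; cong; cong₂; subst; module ≡-Reasoning)

-- Write M = A − λ₀I: it is symmetric with M z ≡ 0, and we fix a coordinate a with p ∤ z a.
-- Linear algebra over 𝔽ₚ is done on integer vectors up to divisibility by p.  Its basis is
-- that m+1 vectors of ℤᵐ are dependent mod p (Gaussian elimination), hence m+1 vectors of
-- ℤ^{m+1} orthogonal to z are dependent, as they lie in the hyperplane z^⊥.
--
-- Upper bound: every column of [M, z] is orthogonal to z (M is symmetric, M z ≡ 0 and
-- z ∙ z ≡ 0), so any n of them are dependent.
-- Lower bound: n−2 independent columns of M together with z stay independent, because z
-- is not in the image of M.  Indeed, if M u ≡ α z and 𝟙 ∙ u ≡ 0, then u ⊥ A^j 𝟙 for all j
-- (A is symmetric and z ⊥ A^j 𝟙), so u is proportional to z since rank_p W = n−1, whence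
-- α ≡ 0.  If z were in the image of M this would make ker M the line spanned by z, so the
-- n−1 columns of M other than a would be independent, contradicting rank_p M = n−2.

punchIn-cases : ∀ {n} (P : Fin (suc n) → Set) a → P a → (∀ j → P (punchIn a j)) → ∀ i → P i
punchIn-cases P a Pa Pothers i with a ≟ i
... | yes refl = Pa
... | no a≢i = subst P (FinP.punchIn-punchOut a≢i) (Pothers (punchOut a≢i))

Σℤ≡sum : ∀ n (f : Fin n → ℤ) → Σℤ n f ≡ sum f
Σℤ≡sum zero f = refl
Σℤ≡sum (suc n) f = cong (λ s → f zero + s) (Σℤ≡sum n (λ i → f (suc i)))

Σ-cong : ∀ n {f g : Fin n → ℤ} → (∀ i → f i ≡ g i) → Σℤ n f ≡ Σℤ n g
Σ-cong n {f} {g} f≗g rewrite Σℤ≡sum n f | Σℤ≡sum n g = sum-cong-≗ f≗g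

Σ-+ : ∀ n (f g : Fin n → ℤ) → Σℤ n (λ i → f i + g i) ≡ Σℤ n f + Σℤ n g
Σ-+ n f g rewrite Σℤ≡sum n f | Σℤ≡sum n g | Σℤ≡sum n (λ i → f i + g i) = ∑-distrib-+ f g

Σ-*ˡ : ∀ n a (f : Fin n → ℤ) → Σℤ n (λ i → a * f i) ≡ a * Σℤ n f
Σ-*ˡ n a f rewrite Σℤ≡sum n f | Σℤ≡sum n (λ i → a * f i) = sym (*-distribˡ-sum a f)

Σ-zero : ∀ n → Σℤ n (λ _ → + 0) ≡ + 0
Σ-zero n = trans (Σℤ≡sum n _) (sum-replicate-zero n)

Σ-*ʳ : ∀ n a (f : Fin n → ℤ) → Σℤ n (λ i → f i * a) ≡ Σℤ n f * a
Σ-*ʳ n a f rewrite Σℤ≡sum n f | Σℤ≡sum n (λ i → f i * a) = sym (*-distribʳ-sum a f)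

Σ-swap : ∀ m k (f : Fin m → Fin k → ℤ) →
  Σℤ m (λ i → Σℤ k (f i)) ≡ Σℤ k (λ j → Σℤ m (λ i → f i j))
Σ-swap m k f = begin
  Σℤ m (λ i → Σℤ k (f i))        ≡⟨ Σ-cong m (λ i → Σℤ≡sum k (f i)) ⟩
  Σℤ m (λ i → sum (f i))         ≡⟨ Σℤ≡sum m _ ⟩
  sum (λ i → sum (f i))          ≡⟨ ∑-comm f ⟩
  sum (λ j → sum (λ i → f i j))  ≡⟨ sym (Σℤ≡sum k _) ⟩
  Σℤ k (λ j → sum (λ i → f i j)) ≡⟨ sym (Σ-cong k (λ j → Σℤ≡sum m (λ i → f i j))) ⟩
  Σℤ k (λ j → Σℤ m (λ i → f i j)) ∎
  where open ≡-Reasoning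

Σ-linear : ∀ n a b (f g : Fin n → ℤ) →
  Σℤ n (λ i → a * f i + b * g i) ≡ a * Σℤ n f + b * Σℤ n g
Σ-linear n a b f g = trans (Σ-+ n _ _) (cong₂ _+_ (Σ-*ˡ n a f) (Σ-*ˡ n b g))

Σ-remove : ∀ n (f : Fin (suc n) → ℤ) (a : Fin (suc n)) →
  Σℤ (suc n) f ≡ f a + Σℤ n (λ j → f (punchIn a j))
Σ-remove n f a rewrite Σℤ≡sum (suc n) f | Σℤ≡sum n (λ j → f (punchIn a j)) = sum-remove f

infix 8 _∙_
_∙_ : ∀ {n} → Vecℤ n → Vecℤ n → ℤ
_∙_ {n} u v = Σℤ n (λ i → u i * v i)

∙-comm : ∀ {n} (u v : Vecℤ n) → u ∙ v ≡ v ∙ u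
∙-comm {n} u v = Σ-cong n (λ i → ℤ.*-comm (u i) (v i))

combo : ∀ {k m} → (Fin k → ℤ) → (Fin k → Vecℤ m) → Vecℤ m
combo {k} c v i = Σℤ k (λ t → c t * v t i)

∙-linear : ∀ {n} (w x y : Vecℤ n) a b →
  w ∙ (λ i → a * x i + b * y i) ≡ a * (w ∙ x) + b * (w ∙ y)
∙-linear {n} w x y a b =
  trans (Σ-cong n (λ i → distribute (w i) a (x i) b (y i))) (Σ-linear n a b _ _)
  where
  distribute : ∀ w a x b y → w * (a * x + b * y) ≡ a * (w * x) + b * (w * y)
  distribute = solve-∀

combo-∙ : ∀ {k m} (c : Fin k → ℤ) (v : Fin k → Vecℤ m) (z : Vecℤ m) →
  combo c v ∙ z ≡ Σℤ k (λ t → c t * (v t ∙ z))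
combo-∙ {k} {m} c v z = begin
  Σℤ m (λ i → Σℤ k (λ t → c t * v t i) * z i)
    ≡⟨ Σ-cong m (λ i → sym (Σ-*ʳ k (z i) _)) ⟩
  Σℤ m (λ i → Σℤ k (λ t → c t * v t i * z i))
    ≡⟨ Σ-swap m k _ ⟩
  Σℤ k (λ t → Σℤ m (λ i → c t * v t i * z i))
    ≡⟨ Σ-cong k (λ t → trans (Σ-cong m (λ i → ℤ.*-assoc (c t) (v t i) (z i))) (Σ-*ˡ m (c t) _)) ⟩
  Σℤ k (λ t → c t * (v t ∙ z)) ∎
  where open ≡-Reasoning

·ᵥ-self-adjoint : ∀ {n} (A : Matℤ n n) → (∀ i j → A i j ≡ A j i) → (x u : Vecℤ n) →
  (A ·ᵥ x) ∙ u ≡ x ∙ (A ·ᵥ u)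
·ᵥ-self-adjoint {n} A A-sym x u = begin
  (A ·ᵥ x) ∙ u                                ≡⟨ Σ-cong n (λ i → cong (_* u i) (Σ-cong n (λ j → ℤ.*-comm (A i j) (x j)))) ⟩
  combo x (λ j i → A i j) ∙ u                  ≡⟨ combo-∙ x (λ j i → A i j) u ⟩
  Σℤ n (λ j → x j * Σℤ n (λ i → A i j * u i))  ≡⟨ Σ-cong n (λ j → cong (x j *_) (Σ-cong n (λ i → cong (_* u i) (A-sym i j)))) ⟩
  x ∙ (A ·ᵥ u) ∎
  where open ≡-Reasoning

idℤ-diag : ∀ {n} (i : Fin n) → idℤ i i ≡ + 1
idℤ-diag i with i ≟ i
... | yes _ = refl
... | no i≢i = ⊥-elim (i≢i refl)

idℤ-off : ∀ {n} (i j : Fin n) → i ≢ j → idℤ i j ≡ + 0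
idℤ-off i j i≢j with i ≟ j
... | yes i≡j = ⊥-elim (i≢j i≡j)
... | no _ = refl

idℤ-sym : ∀ {n} (i j : Fin n) → idℤ i j ≡ idℤ j i
idℤ-sym i j with i ≟ j | j ≟ i
... | yes _ | yes _ = refl
... | no _ | no _ = refl
... | yes i≡j | no j≢i = ⊥-elim (j≢i (sym i≡j))
... | no i≢j | yes j≡i = ⊥-elim (i≢j (sym j≡i))

idℤ-∙ : ∀ {n} (a : Fin n) (u : Vecℤ n) → idℤ a ∙ u ≡ u a
idℤ-∙ {suc n} a u = begin
  idℤ a ∙ u
    ≡⟨ Σ-remove n (λ j → idℤ a j * u j) a ⟩
  idℤ a a * u a + Σℤ n (λ j → idℤ a (punchIn a j) * u (punchIn a j))
    ≡⟨ cong₂ _+_ (cong (_* u a) (idℤ-diag a))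
                 (Σ-cong n (λ j → cong (_* u (punchIn a j)) (idℤ-off a (punchIn a j) (FinP.punchInᵢ≢i a j ∘ sym)))) ⟩
  + 1 * u a + Σℤ n (λ _ → + 0)
    ≡⟨ cong₂ _+_ (ℤ.*-identityˡ (u a)) (Σ-zero n) ⟩
  u a + + 0
    ≡⟨ ℤ.+-identityʳ (u a) ⟩
  u a ∎
  where open ≡-Reasoning

shift-·ᵥ : ∀ {n} (A : Matℤ n n) λ₀ (u : Vecℤ n) i → (shift A λ₀ ·ᵥ u) i ≡ (A ·ᵥ u) i - λ₀ * u i
shift-·ᵥ {n} A λ₀ u i = begin
  Σℤ n (λ j → (A i j - λ₀ * idℤ i j) * u j)
    ≡⟨ Σ-cong n (λ j → expand (A i j) λ₀ (idℤ i j) (u j)) ⟩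
  Σℤ n (λ j → + 1 * (A i j * u j) + - λ₀ * (idℤ i j * u j))
    ≡⟨ Σ-linear n (+ 1) (- λ₀) _ _ ⟩
  + 1 * (A ·ᵥ u) i + - λ₀ * (idℤ i ∙ u)
    ≡⟨ cong (λ x → + 1 * (A ·ᵥ u) i + - λ₀ * x) (idℤ-∙ i u) ⟩
  + 1 * (A ·ᵥ u) i + - λ₀ * u i
    ≡⟨ collect ((A ·ᵥ u) i) λ₀ (u i) ⟩
  (A ·ᵥ u) i - λ₀ * u i ∎
  where
  open ≡-Reasoning
  expand : ∀ x l d v → (x - l * d) * v ≡ + 1 * (x * v) + - l * (d * v)
  expand = solve-∀
  collect : ∀ x l v → + 1 * x + - l * v ≡ x - l * v
  collect = solve-∀

shift-sym : ∀ {n} (A : Matℤ n n) → (∀ i j → A i j ≡ A j i) → ∀ λ₀ i j → shift A λ₀ i j ≡ shift A λ₀ j i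
shift-sym A A-sym λ₀ i j = cong₂ _-_ (A-sym i j) (cong (λ₀ *_) (idℤ-sym i j))

spread : ∀ {n r} → (Fin r → Fin n) → (Fin r → ℤ) → Vecℤ n
spread f c = combo c (λ t → idℤ (f t))

·ᵥ-spread : ∀ {m n r} (M : Matℤ m n) (f : Fin r → Fin n) (c : Fin r → ℤ) i →
  (M ·ᵥ spread f c) i ≡ combo c (λ t i → M i (f t)) i
·ᵥ-spread {r = r} M f c i = begin
  M i ∙ spread f c                          ≡⟨ ∙-comm (M i) (spread f c) ⟩
  spread f c ∙ M i                          ≡⟨ combo-∙ c (λ t → idℤ (f t)) (M i) ⟩
  Σℤ r (λ t → c t * (idℤ (f t) ∙ M i))      ≡⟨ Σ-cong r (λ t → cong (c t *_) (idℤ-∙ (f t) (M i))) ⟩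
  combo c (λ t i → M i (f t)) i ∎
  where open ≡-Reasoning

·ᵥ-insertAt-zero : ∀ {m n} (M : Matℤ m (suc n)) (d : Fin n → ℤ) a i →
  (M ·ᵥ insertAt d a (+ 0)) i ≡ combo d (λ t i → M i (punchIn a t)) i
·ᵥ-insertAt-zero {n = n} M d a i = begin
  (M ·ᵥ w) i
    ≡⟨ Σ-remove n (λ j → M i j * w j) a ⟩
  M i a * w a + Σℤ n (λ t → M i (punchIn a t) * w (punchIn a t))
    ≡⟨ cong₂ _+_ (trans (cong (M i a *_) (insertAt-lookup d a (+ 0))) (ℤ.*-zeroʳ (M i a)))
                 (Σ-cong n (λ t → trans (cong (M i (punchIn a t) *_) (insertAt-punchIn d a (+ 0) t))
                                        (ℤ.*-comm (M i (punchIn a t)) (d t)))) ⟩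
  + 0 + combo d (λ t i → M i (punchIn a t)) i
    ≡⟨ ℤ.+-identityˡ _ ⟩
  combo d (λ t i → M i (punchIn a t)) i ∎
  where
  open ≡-Reasoning
  w = insertAt d a (+ 0)

appendCol-inject₁ : ∀ {m k} (M : Matℤ m k) (z : Vecℤ m) i (j : Fin k) → appendCol M z i (inject₁ j) ≡ M i j
appendCol-inject₁ {k = k} M z i j with toℕ (inject₁ j) ℕ.<? k
... | yes j<k = cong (M i) (FinP.toℕ-injective (trans (FinP.toℕ-fromℕ< j<k) (FinP.toℕ-inject₁ j)))
... | no j≮k = ⊥-elim (j≮k (subst (_< k) (sym (FinP.toℕ-inject₁ j)) (FinP.toℕ<n j)))

appendCol-last : ∀ {m k} (M : Matℤ m k) (z : Vecℤ m) i → appendCol M z i (fromℕ k) ≡ z i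
appendCol-last {k = k} M z i with toℕ (fromℕ k) ℕ.<? k
... | yes k<k = ⊥-elim (ℕ.n≮n k (subst (_< k) (FinP.toℕ-fromℕ k) k<k))
... | no _ = refl

appendCol-column : ∀ {m k} (M : Matℤ m k) (z : Vecℤ m) (j : Fin (suc k)) →
  (Σ (Fin k) λ j′ → ∀ i → appendCol M z i j ≡ M i j′) ⊎ (∀ i → appendCol M z i j ≡ z i)
appendCol-column {k = k} M z j with toℕ j ℕ.<? k
... | yes j<k = inj₁ (fromℕ< j<k , λ i → refl)
... | no _ = inj₂ (λ i → refl)

lastThen : ∀ {k r} → (Fin r → Fin k) → Fin (suc r) → Fin (suc k)
lastThen {k} f zero = fromℕ k
lastThen f (suc t) = inject₁ (f t)

appendCol-combo : ∀ {m k r} (M : Matℤ m k) (z : Vecℤ m) (f : Fin r → Fin k) (c : Fin (suc r) → ℤ) i →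
  combo c (λ t i → appendCol M z i (lastThen f t)) i ≡
  c zero * z i + combo (λ t → c (suc t)) (λ t i → M i (f t)) i
appendCol-combo {r = r} M z f c i =
  cong₂ _+_ (cong (c zero *_) (appendCol-last M z i))
            (Σ-cong r (λ t → cong (c (suc t) *_) (appendCol-inject₁ M z i (f t))))

module ModPrime (p : ℕ) (p-prime : Prime p) where

  infix 4 p∣_
  p∣_ : ℤ → Set
  p∣ x = + p ℤ∣.∣ x

  p∣? : ∀ x → Dec (p∣ x)
  p∣? x = + p ℤ∣.∣? x

  p∣0 : p∣ + 0
  p∣0 = ℤ∣.divides (+ 0) refl

  ¬p∣1 : ¬ p∣ + 1
  ¬p∣1 p∣1 = ¬prime[1] (subst Prime (ℕ∣.∣1⇒≡1 (ℤ∣.∣⇒∣ᵤ p∣1)) p-prime)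

  p∣-product : ∀ x y → p∣ x * y → p∣ x ⊎ p∣ y
  p∣-product x y p∣xy with euclidsLemma ∣ x ∣ ∣ y ∣ p-prime (subst (p ℕ∣.∣_) (ℤ.abs-* x y) (ℤ∣.∣⇒∣ᵤ p∣xy))
  ... | inj₁ p∣x = inj₁ (ℤ∣.∣ᵤ⇒∣ p∣x)
  ... | inj₂ p∣y = inj₂ (ℤ∣.∣ᵤ⇒∣ p∣y)

  p∣-cancelʳ : ∀ {x y} → ¬ p∣ y → p∣ x * y → p∣ x
  p∣-cancelʳ {x} {y} p∤y p∣xy with p∣-product x y p∣xy
  ... | inj₁ p∣x = p∣x
  ... | inj₂ p∣y = ⊥-elim (p∤y p∣y)

  p∣-cancelˡ : ∀ {x y} → ¬ p∣ x → p∣ x * y → p∣ y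
  p∣-cancelˡ {x} {y} p∤x p∣xy = p∣-cancelʳ p∤x (subst p∣_ (ℤ.*-comm x y) p∣xy)

  p∣-Σ : ∀ n {f : Fin n → ℤ} → (∀ i → p∣ f i) → p∣ Σℤ n f
  p∣-Σ zero _ = p∣0
  p∣-Σ (suc n) p∣f = ℤ∣.∣m∣n⇒∣m+n (p∣f zero) (p∣-Σ n (λ i → p∣f (suc i)))

  p∣-last-term : ∀ n (f : Fin (suc n) → ℤ) a →
    p∣ Σℤ (suc n) f → (∀ j → p∣ f (punchIn a j)) → p∣ f a
  p∣-last-term n f a p∣Σ p∣others =
    ℤ∣.∣m+n∣n⇒∣m (subst p∣_ (Σ-remove n f a) p∣Σ) (p∣-Σ n p∣others)

  ≡mod⇒p∣ : ∀ {x y} → x ≡ y [mod p ] → p∣ x - y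
  ≡mod⇒p∣ = ℤ∣.∣ᵤ⇒∣

  ≡0⇒p∣ : ∀ {x} → x ≡ + 0 [mod p ] → p∣ x
  ≡0⇒p∣ {x} x≡0 = subst p∣_ (ℤ.+-identityʳ x) (≡mod⇒p∣ {x} {+ 0} x≡0)

  p∣⇒≡0 : ∀ {x} → p∣ x → x ≡ + 0 [mod p ]
  p∣⇒≡0 {x} p∣x = ℤ∣.∣⇒∣ᵤ (subst p∣_ (sym (ℤ.+-identityʳ x)) p∣x)

  ∙-congruent : ∀ {n} (w x y : Vecℤ n) → (∀ i → p∣ x i - y i) → p∣ w ∙ x - w ∙ y
  ∙-congruent {n} w x y x≡y = subst p∣_ (trans (∙-linear w x y (+ 1) (- + 1)) (collect (w ∙ x) (w ∙ y)))
    (p∣-Σ n (λ i → subst p∣_ (cong (w i *_) (expand (x i) (y i))) (ℤ∣.∣n⇒∣m*n (w i) (x≡y i))))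
    where
    expand : ∀ x y → x - y ≡ + 1 * x + - + 1 * y
    expand = solve-∀
    collect : ∀ x y → + 1 * x + - + 1 * y ≡ x - y
    collect = solve-∀

  isotropic-1d : (z : Vecℤ 1) → p∣ z ∙ z → ∀ i → p∣ z i
  isotropic-1d z p∣z∙z zero with p∣-product (z zero) (z zero) (subst p∣_ (ℤ.+-identityʳ _) p∣z∙z)
  ... | inj₁ p∣z₀ = p∣z₀
  ... | inj₂ p∣z₀ = p∣z₀

  Dependent : ∀ {k m} → (Fin k → Vecℤ m) → Set
  Dependent {k} v = Σ (Fin k → ℤ) λ c → (Σ (Fin k) λ t → ¬ p∣ c t) × (∀ i → p∣ combo c v i)

  dependent⇒¬independent : ∀ {m k r} (M : Matℤ m k) (f : Fin r → Fin k) →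
    Dependent (λ t i → M i (f t)) → ¬ ColumnsIndependentMod p M f
  dependent⇒¬independent M f (c , (t , p∤ct) , vanishes) independent =
    p∤ct (≡0⇒p∣ (independent c (λ i → p∣⇒≡0 (vanishes i)) t))

  Dependent-vanishing-coord : ∀ {k m} (v : Fin k → Vecℤ (suc m)) → (∀ t → p∣ v t zero) →
    Dependent (λ t i → v t (suc i)) → Dependent v
  Dependent-vanishing-coord {k} v p∣v₀ (c , nonzero , vanishes) = c , nonzero , λ where
    zero → p∣-Σ k (λ t → ℤ∣.∣n⇒∣m*n (c t) (p∣v₀ t))
    (suc i) → vanishes i

  Dependent-cons : ∀ {k m} (v : Fin (suc k) → Vecℤ m) → Dependent (λ t → v (suc t)) → Dependent v
  Dependent-cons v (c , (t , p∤ct) , vanishes) =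
    insertAt c zero (+ 0) , (suc t , p∤ct) ,
    λ i → ℤ∣.∣m∣n⇒∣m+n (ℤ∣.∣m⇒∣m*n (v zero i) p∣0) (vanishes i)

  -- Gaussian elimination with pivot vector w = v t₀: if the vectors a·u_j − b_j·w,
  -- where u_j are the other vectors and p ∤ a, are dependent, then so is v.
  Dependent-eliminate : ∀ {k m} (v : Fin (suc k) → Vecℤ m) (t₀ : Fin (suc k)) (a : ℤ) (b : Fin k → ℤ) →
    ¬ p∣ a → Dependent (λ j i → a * v (punchIn t₀ j) i - b j * v t₀ i) → Dependent v
  Dependent-eliminate {k} v t₀ a b p∤a (c , (t , p∤ct) , vanishes) =
    c′ , (punchIn t₀ t , p∤c′t) , λ i → subst p∣_ (sym (same-combination i)) (vanishes i)
    where
    S = Σℤ k (λ j → c j * b j)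
    c′ : Fin (suc k) → ℤ
    c′ = insertAt (λ j → a * c j) t₀ (- S)
    p∤c′t : ¬ p∣ c′ (punchIn t₀ t)
    p∤c′t p∣c′t = p∤ct (p∣-cancelˡ p∤a (subst p∣_ (insertAt-punchIn (λ j → a * c j) t₀ (- S) t) p∣c′t))
    same-combination : ∀ i → combo c′ v i ≡ combo c (λ j i → a * v (punchIn t₀ j) i - b j * v t₀ i) i
    same-combination i = begin
      combo c′ v i
        ≡⟨ Σ-remove k (λ t → c′ t * v t i) t₀ ⟩
      c′ t₀ * w + Σℤ k (λ j → c′ (punchIn t₀ j) * u j)
        ≡⟨ cong₂ _+_ (cong (_* w) (insertAt-lookup (λ j → a * c j) t₀ (- S)))
                     (Σ-cong k (λ j → cong (_* u j) (insertAt-punchIn (λ j → a * c j) t₀ (- S) j))) ⟩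
      - S * w + Σℤ k (λ j → a * c j * u j)
        ≡⟨ cong (_+ Σℤ k (λ j → a * c j * u j)) (move-sign S w) ⟩
      S * - w + Σℤ k (λ j → a * c j * u j)
        ≡⟨ cong (_+ Σℤ k (λ j → a * c j * u j)) (sym (Σ-*ʳ k (- w) _)) ⟩
      Σℤ k (λ j → c j * b j * - w) + Σℤ k (λ j → a * c j * u j)
        ≡⟨ sym (Σ-+ k _ _) ⟩
      Σℤ k (λ j → c j * b j * - w + a * c j * u j)
        ≡⟨ Σ-cong k (λ j → regroup (c j) (b j) w a (u j)) ⟩
      combo c (λ j i → a * v (punchIn t₀ j) i - b j * v t₀ i) i ∎
      where
      open ≡-Reasoning
      w = v t₀ i
      u : Fin k → ℤ
      u j = v (punchIn t₀ j) i
      move-sign : ∀ s w → - s * w ≡ s * - w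
      move-sign = solve-∀
      regroup : ∀ c b w a u → c * b * - w + a * c * u ≡ c * (a * u - b * w)
      regroup = solve-∀

  -- m+1 vectors in ℤᵐ are dependent modulo p, by elimination on the first coordinate.
  overdetermined : ∀ m (v : Fin (suc m) → Vecℤ m) → Dependent v
  overdetermined zero v = (λ _ → + 1) , (zero , ¬p∣1) , λ ()
  overdetermined (suc m) v with FinP.all? (λ t → p∣? (v t zero))
  ... | yes p∣v₀ = Dependent-cons v (Dependent-vanishing-coord (λ t → v (suc t)) (λ t → p∣v₀ (suc t))
                     (overdetermined m (λ t i → v (suc t) (suc i))))
  ... | no ¬p∣v₀ = eliminate (FinP.¬∀⟶∃¬ (suc (suc m)) _ (λ t → p∣? (v t zero)) ¬p∣v₀)
    where
    eliminate : Σ (Fin (suc (suc m))) (λ t → ¬ p∣ v t zero) → Dependent v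
    eliminate (t₀ , p∤a) = Dependent-eliminate v t₀ a b p∤a
      (Dependent-vanishing-coord reduced reduced-vanishes (overdetermined m (λ j i → reduced j (suc i))))
      where
      a = v t₀ zero
      b : Fin (suc m) → ℤ
      b j = v (punchIn t₀ j) zero
      reduced : Fin (suc m) → Vecℤ (suc m)
      reduced j i = a * v (punchIn t₀ j) i - b j * v t₀ i
      cancel : ∀ x y → x * y - y * x ≡ + 0
      cancel = solve-∀
      reduced-vanishes : ∀ j → p∣ reduced j zero
      reduced-vanishes j = subst p∣_ (sym (cancel a (b j))) p∣0

  combo-orthogonal : ∀ {k m} (c : Fin k → ℤ) (v : Fin k → Vecℤ m) (z : Vecℤ m) →
    (∀ t → p∣ v t ∙ z) → p∣ combo c v ∙ z
  combo-orthogonal {k} c v z v⊥z =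
    subst p∣_ (sym (combo-∙ c v z)) (p∣-Σ k (λ t → ℤ∣.∣n⇒∣m*n (c t) (v⊥z t)))

  vanishes-off-support : ∀ m (y z : Vecℤ (suc m)) a → ¬ p∣ z a → p∣ y ∙ z →
    (∀ j → p∣ y (punchIn a j)) → ∀ i → p∣ y i
  vanishes-off-support m y z a p∤za p∣y∙z p∣others = punchIn-cases (λ i → p∣ y i) a p∣ya p∣others
    where
    p∣ya : p∣ y a
    p∣ya = p∣-cancelʳ p∤za (p∣-last-term m (λ i → y i * z i) a p∣y∙z
                              (λ j → ℤ∣.∣m⇒∣m*n (z (punchIn a j)) (p∣others j)))

  Dependent-restore-coord : ∀ {k} m (v : Fin k → Vecℤ (suc m)) (z : Vecℤ (suc m)) a → ¬ p∣ z a →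
    (∀ t → p∣ v t ∙ z) → Dependent (λ t j → v t (punchIn a j)) → Dependent v
  Dependent-restore-coord m v z a p∤za v⊥z (c , nonzero , vanishes-off-a) =
    c , nonzero , vanishes-off-support m (combo c v) z a p∤za (combo-orthogonal c v z v⊥z) vanishes-off-a

  -- m+1 vectors of ℤ^{m+1} orthogonal to z, with p ∤ z a, lie in the hyperplane z^⊥ of
  -- dimension m over 𝔽ₚ, hence are dependent.
  hyperplane-dependent : ∀ m (v : Fin (suc m) → Vecℤ (suc m)) (z : Vecℤ (suc m)) a → ¬ p∣ z a →
    (∀ t → p∣ v t ∙ z) → Dependent v
  hyperplane-dependent m v z a p∤za v⊥z =
    Dependent-restore-coord m v z a p∤za v⊥z (overdetermined m (λ t j → v t (punchIn a j)))

  -- If r+1 independent vectors of ℤ^{r+2} are orthogonal to z and to u modulo p, and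
  -- p ∤ z a, then u is proportional to z: all 2×2 minors of [z, u] vanish mod p.
  orthogonal-line : ∀ r (v : Fin (suc r) → Vecℤ (suc (suc r))) → ¬ Dependent v →
    (z u : Vecℤ (suc (suc r))) (a : Fin (suc (suc r))) → ¬ p∣ z a → (∀ t → p∣ v t ∙ z) → (∀ t → p∣ v t ∙ u) →
    ∀ b → p∣ z a * u b - u a * z b
  orthogonal-line r v independent z u a p∤za v⊥z v⊥u b =
    decidable-stable (p∣? (u′ b)) (λ p∤u′b → independent (dependent p∤u′b))
    where
    -- u′ = (z a)·u − (u a)·z is orthogonal to every v t and vanishes at a.
    u′ : Vecℤ (suc (suc r))
    u′ i = z a * u i - u a * z i
    u′a≡0 : u′ a ≡ + 0
    u′a≡0 = cancel (z a) (u a)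
      where
      cancel : ∀ x y → x * y - y * x ≡ + 0
      cancel = solve-∀
    v⊥u′ : ∀ t → p∣ v t ∙ u′
    v⊥u′ t = subst p∣_ (sym (trans (Σ-cong (suc (suc r)) (λ i → cong (v t i *_) (as-sum (z a) (u i) (u a) (z i))))
                                   (∙-linear (v t) u z (z a) (- u a))))
                       (ℤ∣.∣m∣n⇒∣m+n (ℤ∣.∣n⇒∣m*n (z a) (v⊥u t)) (ℤ∣.∣n⇒∣m*n (- u a) (v⊥z t)))
      where
      as-sum : ∀ x y w s → x * y - w * s ≡ x * y + - w * s
      as-sum = solve-∀
    restricted-v⊥u′ : ∀ t → p∣ (λ j → v t (punchIn a j)) ∙ (λ j → u′ (punchIn a j))
    restricted-v⊥u′ t = ℤ∣.∣m+n∣m⇒∣n (subst p∣_ (Σ-remove (suc r) (λ i → v t i * u′ i) a) (v⊥u′ t))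
                                      (subst (λ x → p∣ v t a * x) (sym u′a≡0) (ℤ∣.∣n⇒∣m*n (v t a) p∣0))
    dependent : ¬ p∣ u′ b → Dependent v
    dependent p∤u′b = Dependent-restore-coord (suc r) v z a p∤za v⊥z
      (hyperplane-dependent r (λ t j → v t (punchIn a j)) (λ j → u′ (punchIn a j)) (punchOut a≢b)
        (λ p∣u′b → p∤u′b (subst (λ i → p∣ u′ i) (FinP.punchIn-punchOut a≢b) p∣u′b)) restricted-v⊥u′)
      where
      a≢b : a ≢ b
      a≢b refl = p∤u′b (subst p∣_ (sym u′a≡0) p∣0)

  module Walks (n : ℕ) (A : Matℤ n n) (A-sym : ∀ i j → A i j ≡ A j i)
               (λ₀ : ℤ) (z : Vecℤ n) (z⊥W : ∀ j → j < n → p∣ walkVec A j ∙ z) where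

    M : Matℤ n n
    M = shift A λ₀

    MapsTo : Vecℤ n → ℤ → Set
    MapsTo u α = ∀ i → p∣ (M ·ᵥ u) i - α * z i

    -- If M u ≡ α z and u ⊥ 𝟙 modulo p, then u ⊥ A^j 𝟙 for all j < n, because
    -- A u ≡ α z + λ₀ u, A is symmetric and z ⊥ A^j 𝟙.
    walk-orthogonal : ∀ u α → MapsTo u α → p∣ 𝟙 ∙ u → ∀ j → j < n → p∣ walkVec A j ∙ u
    walk-orthogonal u α Mu≡αz 𝟙⊥u zero _ = 𝟙⊥u
    walk-orthogonal u α Mu≡αz 𝟙⊥u (suc j) j+1<n =
      subst p∣_ (trans (restore (w ∙ (A ·ᵥ u)) (w ∙ y)) (sym (·ᵥ-self-adjoint A A-sym w u)))
        (ℤ∣.∣m∣n⇒∣m+n (∙-congruent w (A ·ᵥ u) y Au≡y) w⊥y)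
      where
      j<n = ℕ.<-trans (ℕ.n<1+n j) j+1<n
      w = walkVec A j
      y : Vecℤ n
      y i = α * z i + λ₀ * u i
      Au≡y : ∀ i → p∣ (A ·ᵥ u) i - y i
      Au≡y i = subst p∣_ (trans (cong (_- α * z i) (shift-·ᵥ A λ₀ u i)) (regroup ((A ·ᵥ u) i) λ₀ (u i) α (z i)))
                         (Mu≡αz i)
        where
        regroup : ∀ x l v a s → x - l * v - a * s ≡ x - (a * s + l * v)
        regroup = solve-∀
      w⊥y : p∣ w ∙ y
      w⊥y = subst p∣_ (sym (∙-linear w z u α λ₀))
        (ℤ∣.∣m∣n⇒∣m+n (ℤ∣.∣n⇒∣m*n α (z⊥W j j<n)) (ℤ∣.∣n⇒∣m*n λ₀ (walk-orthogonal u α Mu≡αz 𝟙⊥u j j<n)))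
      restore : ∀ x y → x - y + y ≡ x
      restore = solve-∀

  module Rank (r : ℕ) (A : Matℤ (suc (suc r)) (suc (suc r))) (A-sym : ∀ i j → A i j ≡ A j i)
              (λ₀ : ℤ) (z : Vecℤ (suc (suc r))) (z⊥W : ∀ j → j < suc (suc r) → p∣ walkVec A j ∙ z)
              (fW : Fin (suc r) → Fin (suc (suc r))) (W-independent : ColumnsIndependentMod p (walkMatrix A) fW)
              (Mz≡0 : ∀ i → p∣ (shift A λ₀ ·ᵥ z) i) (a : Fin (suc (suc r))) (p∤za : ¬ p∣ z a) where
    open Walks (suc (suc r)) A A-sym λ₀ z z⊥W

    -- A vector u ⊥ 𝟙 with M u ≡ α z is proportional to z: it is orthogonal to the
    -- r+1 independent walk vectors in fW, which are orthogonal to z as well.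
    eigen-parallel : ∀ u α → MapsTo u α → p∣ 𝟙 ∙ u → ∀ b → p∣ z a * u b - u a * z b
    eigen-parallel u α Mu≡αz 𝟙⊥u = orthogonal-line r (λ t i → walkMatrix A i (fW t))
      (λ dependent → dependent⇒¬independent (walkMatrix A) fW dependent W-independent)
      z u a p∤za (λ t → z⊥W (toℕ (fW t)) (FinP.toℕ<n (fW t)))
      (λ t → walk-orthogonal u α Mu≡αz 𝟙⊥u (toℕ (fW t)) (FinP.toℕ<n (fW t)))

    eigen-coefficient : ∀ u α → MapsTo u α → p∣ 𝟙 ∙ u → p∣ α
    eigen-coefficient u α Mu≡αz 𝟙⊥u = p∣-cancelʳ p∤za p∣αza
      where
      -- q = (z a)·u − (u a)·z ≡ 0, so M q ≡ (z a)·M u.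
      q : Vecℤ (suc (suc r))
      q b = z a * u b + - u a * z b
      q≡0 : ∀ b → p∣ q b
      q≡0 b = subst p∣_ (as-sum (z a) (u b) (u a) (z b)) (eigen-parallel u α Mu≡αz 𝟙⊥u b)
        where
        as-sum : ∀ x y w s → x * y - w * s ≡ x * y + - w * s
        as-sum = solve-∀
      p∣za·Mua : p∣ z a * (M ·ᵥ u) a
      p∣za·Mua = ℤ∣.∣m+n∣n⇒∣m (subst p∣_ (∙-linear (M a) u z (z a) (- u a))
                                       (p∣-Σ (suc (suc r)) (λ b → ℤ∣.∣n⇒∣m*n (M a b) (q≡0 b))))
                              (ℤ∣.∣n⇒∣m*n (- u a) (Mz≡0 a))
      p∣αza : p∣ α * z a
      p∣αza = subst p∣_ (cancel ((M ·ᵥ u) a) α (z a))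
                (ℤ∣.∣m∣n⇒∣m-n (p∣-cancelˡ p∤za p∣za·Mua) (Mu≡αz a))
        where
        cancel : ∀ x a s → x - (x - a * s) ≡ a * s
        cancel = solve-∀

    -- If z lies in the image of M, the kernel of M is the line spanned by z: for
    -- w ∈ ker M, the combination y′ = (𝟙∙w)·y − (𝟙∙y)·w is ⊥ 𝟙, so 𝟙∙w ≡ 0.
    kernel-is-line : ∀ γ y → ¬ p∣ γ → MapsTo y γ →
      ∀ w → MapsTo w (+ 0) → ∀ b → p∣ z a * w b - w a * z b
    kernel-is-line γ y p∤γ My≡γz w Mw≡0 = eigen-parallel w (+ 0) Mw≡0 p∣σ
      where
      σ = 𝟙 ∙ w
      s = 𝟙 ∙ y
      y′ : Vecℤ (suc (suc r))
      y′ i = σ * y i + - s * w i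
      My′≡σγz : MapsTo y′ (σ * γ)
      My′≡σγz i = subst p∣_ (sym (trans (cong (_- σ * γ * z i) (∙-linear (M i) y w σ (- s)))
                                        (regroup σ ((M ·ᵥ y) i) s ((M ·ᵥ w) i) γ (z i))))
                    (ℤ∣.∣m∣n⇒∣m+n (ℤ∣.∣n⇒∣m*n σ (My≡γz i)) (ℤ∣.∣n⇒∣m*n (- s) (Mw≡0 i)))
        where
        regroup : ∀ σ x s v γ t → σ * x + - s * v - σ * γ * t ≡ σ * (x - γ * t) + - s * (v - + 0 * t)
        regroup = solve-∀
      𝟙⊥y′ : p∣ 𝟙 ∙ y′
      𝟙⊥y′ = subst p∣_ (sym (trans (∙-linear 𝟙 y w σ (- s)) (cancel σ s))) p∣0
        where
        cancel : ∀ σ s → σ * s + - s * σ ≡ + 0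
        cancel = solve-∀
      p∣σ : p∣ σ
      p∣σ = p∣-cancelʳ p∤γ (eigen-coefficient y′ (σ * γ) My′≡σγz 𝟙⊥y′)

    -- Since rank_p M ≤ r, z is not in the image of M: otherwise ker M would be the line
    -- of z, and the r+1 columns of M other than a would be independent.
    not-in-image : (∀ (f : Fin (suc r) → Fin (suc (suc r))) → ¬ ColumnsIndependentMod p M f) →
      ∀ γ y → MapsTo y γ → p∣ γ
    not-in-image rank≤r γ y My≡γz =
      decidable-stable (p∣? γ) (λ p∤γ → rank≤r (punchIn a) (others-independent p∤γ))
      where
      others-independent : ¬ p∣ γ → ColumnsIndependentMod p M (punchIn a)
      others-independent p∤γ d Md≡0 t = p∣⇒≡0 (p∣-cancelˡ p∤za (subst p∣_ minor≡za·dt (parallel (punchIn a t))))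
        where
        w = insertAt d a (+ 0)
        Mw≡0 : MapsTo w (+ 0)
        Mw≡0 i = subst p∣_ (trans (sym (·ᵥ-insertAt-zero M d a i)) (sym (ℤ.+-identityʳ _))) (≡0⇒p∣ (Md≡0 i))
        parallel : ∀ b → p∣ z a * w b - w a * z b
        parallel = kernel-is-line γ y p∤γ My≡γz w Mw≡0
        minor≡za·dt : z a * w (punchIn a t) - w a * z (punchIn a t) ≡ z a * d t
        minor≡za·dt = begin
          z a * w (punchIn a t) - w a * z (punchIn a t)
            ≡⟨ cong₂ (λ x y → z a * x - y * z (punchIn a t)) (insertAt-punchIn d a (+ 0) t) (insertAt-lookup d a (+ 0)) ⟩
          z a * d t - + 0 * z (punchIn a t)
            ≡⟨ ℤ.+-identityʳ (z a * d t) ⟩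
          z a * d t ∎
          where open ≡-Reasoning

    -- Lower bound: the independent columns fM of M together with z stay independent,
    -- because a relation c₀ z + M y ≡ 0 forces p ∣ c₀.
    lastThen-independent : (∀ (f : Fin (suc r) → Fin (suc (suc r))) → ¬ ColumnsIndependentMod p M f) →
      (fM : Fin r → Fin (suc (suc r))) → ColumnsIndependentMod p M fM →
      ColumnsIndependentMod p (appendCol M z) (lastThen fM)
    lastThen-independent rank≤r fM M-independent c vanishes = λ where
        zero → p∣⇒≡0 p∣c₀
        (suc t) → M-independent c₊ (λ i → p∣⇒≡0 (p∣Mc₊ i)) t
      where
      c₀ = c zero
      c₊ : Fin r → ℤ
      c₊ t = c (suc t)
      split : ∀ i → p∣ c₀ * z i + combo c₊ (λ t i → M i (fM t)) i
      split i = subst p∣_ (appendCol-combo M z fM c i) (≡0⇒p∣ (vanishes i))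
      My≡-c₀z : MapsTo (spread fM c₊) (- c₀)
      My≡-c₀z i = subst p∣_ (trans (reorder c₀ (z i) _) (cong (_- - c₀ * z i) (sym (·ᵥ-spread M fM c₊ i)))) (split i)
        where
        reorder : ∀ c z s → c * z + s ≡ s - - c * z
        reorder = solve-∀
      p∣c₀ : p∣ c₀
      p∣c₀ = subst p∣_ (ℤ.neg-involutive c₀) (ℤ∣.∣m⇒∣-m (not-in-image rank≤r (- c₀) (spread fM c₊) My≡-c₀z))
      p∣Mc₊ : ∀ i → p∣ combo c₊ (λ t i → M i (fM t)) i
      p∣Mc₊ i = ℤ∣.∣m+n∣m⇒∣n (split i) (ℤ∣.∣m⇒∣m*n (z i) p∣c₀)

    -- Every column of [M, z] is orthogonal to z: M is symmetric with M z ≡ 0, and z ∙ z ≡ 0.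
    appendCol-orthogonal : p∣ z ∙ z → ∀ j → p∣ (λ i → appendCol M z i j) ∙ z
    appendCol-orthogonal p∣z∙z j with appendCol-column M z j
    ... | inj₁ (j′ , column-of-M) =
      subst p∣_ (Σ-cong (suc (suc r)) (λ i → cong (_* z i) (sym (trans (column-of-M i) (shift-sym A A-sym λ₀ i j′)))))
            (Mz≡0 j′)
    ... | inj₂ column-z = subst p∣_ (Σ-cong (suc (suc r)) (λ i → cong (_* z i) (sym (column-z i)))) p∣z∙z

    -- Upper bound: any r+2 columns of [M, z] lie in the hyperplane z^⊥, so are dependent.
    appendCol-dependent : p∣ z ∙ z → ∀ (f : Fin (suc (suc r)) → Fin (suc (suc (suc r)))) →
      ¬ ColumnsIndependentMod p (appendCol M z) f
    appendCol-dependent p∣z∙z f = dependent⇒¬independent (appendCol M z) f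
      (hyperplane-dependent (suc r) (λ t i → appendCol M z i (f t)) z a p∤za (λ t → appendCol-orthogonal p∣z∙z (f t)))

lemma3p7 : (n : ℕ) (A : Matℤ n n) → IsAdjacencyℤ A →
    det n (walkMatrix A) ≢ + 0 →
    (Q : Matℚ n n) → IsOrthogonal Q → FixesOnes Q → IsAdjacencyℚ (conjugate Q A) →
    (ℓ : ℕ) → IsLevel Q ℓ →
    (p : ℕ) → Prime p → ¬ (2 ∣ p) → p ∣ ℓ →
    RankMod p (walkMatrix A) (n ∸ 1) →
    (z : Vecℤ n) →
    (∀ i → (transposeℤ (walkMatrix A) ·ᵥ z) i ≡ + 0 [mod p ]) →
    Σℤ n (λ i → z i * z i) ≡ + 0 [mod p ] →
    ¬ (∀ i → z i ≡ + 0 [mod p ]) →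
    (λ₀ : ℤ) → (∀ i → (A ·ᵥ z) i ≡ λ₀ * z i [mod p ]) →
    RankMod p (shift A λ₀) (n ∸ 2) →
    RankMod p (appendCol (shift A λ₀) z) (n ∸ 1)
lemma3p7 zero _ _ _ _ _ _ _ _ _ _ _ _ _ _ _ _ _ z≢0 _ _ _ = ⊥-elim (z≢0 (λ ()))
lemma3p7 (suc zero) _ _ _ _ _ _ _ _ _ p p-prime _ _ _ z _ z∙z≡0 z≢0 _ _ _ =
  ⊥-elim (z≢0 (λ i → p∣⇒≡0 (isotropic-1d z (≡0⇒p∣ z∙z≡0) i)))
  where open ModPrime p p-prime
lemma3p7 (suc (suc r)) A (_ , A-sym , _) _ _ _ _ _ _ _ p p-prime _ _ ((fW , W-independent) , _)
         z W⊥z z∙z≡0 z≢0 λ₀ Az≡λ₀z ((fM , M-independent) , rank≤r) =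
  (lastThen fM , lastThen-independent rank≤r fM M-independent) , appendCol-dependent (≡0⇒p∣ z∙z≡0)
  where
  open ModPrime p p-prime
  pivot : Σ (Fin (suc (suc r))) (λ a → ¬ p∣ z a)
  pivot = FinP.¬∀⟶∃¬ _ _ (λ i → p∣? (z i)) (λ p∣z → z≢0 (λ i → p∣⇒≡0 (p∣z i)))
  z⊥W : ∀ j → j < suc (suc r) → p∣ walkVec A j ∙ z
  z⊥W j j<n = subst (λ k → p∣ walkVec A k ∙ z) (FinP.toℕ-fromℕ< j<n) (≡0⇒p∣ (W⊥z (fromℕ< j<n)))
  Mz≡0 : ∀ i → p∣ (shift A λ₀ ·ᵥ z) i
  Mz≡0 i = subst p∣_ (sym (shift-·ᵥ A λ₀ z i)) (≡mod⇒p∣ {(A ·ᵥ z) i} {λ₀ * z i} (Az≡λ₀z i))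
  open Rank r A A-sym λ₀ z z⊥W fW W-independent Mz≡0 (proj₁ pivot) (proj₂ pivot)
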